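{- Let $G$ be a looped simple graph and $k_1,k_2\in\mathbb{N}$. The following are equivalent: (1) $G$ is locally equivalent to some graph $H$ with two nonadjacent vertices of degrees $k_1-1$ and $k_2-1$ which do not share any neighbor; (2) $G$ has a transverse matroid with two disjoint circuits of sizes $k_1$ and $k_2$ whose union contains no other circuit.
   Context: A looped simple graph is a finite graph with loops allowed but no two edges on the same set of end-vertices; neighbors are distinct adjacent vertices, and loops are not counted in degrees. $A(G)$ is the adjacency matrix over $GF(2)$ with diagonal entry $1$ exactly at looped vertices. $IAS(G)=(I\;A(G)\;A(G)+I)$ over $GF(2)$, with $v$ columns labeled $\phi_G(v),\chi_G(v),\psi_G(v)$; $W(G)$ is the set of labels and $M[IAS(G)]$ the binary matroid on $W(G)$ represented by $IAS(G)$. A transversal is a subset of $W(G)$ containing exactly one element of each vertex triple $\{\phi_G(v),\chi_G(v),\psi_G(v)\}$; a transverse matroid is the restriction of $M[IAS(G)]$ to a transversal. Local equivalence: $G^v_\ell$ complements the loop status of $v$; $G^v_s$ complements the adjacency status of every pair of distinct neighbors of $v$; $G^v_{ns}$ does the same and also complements the loop status of every neighbor of $v$; $H$ is locally equivalent to $G$ if obtained from $G$ by a finite sequence of such operations. -}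

module Defs where

open import Data.Nat using (ℕ; zero; suc; _+_)
open import Data.Bool using (Bool; true; false; not; _∧_; _xor_; if_then_else_)
open import Data.Fin using (Fin; zero; suc; _≟_)
open import Data.Fin.Subset using (Subset; _∈_; _⊆_; _⊂_; _∩_; _∪_; ∣_∣; Nonempty; ⊥)
open import Data.Vec using (tabulate; lookup)
open import Data.Product using (Σ; ∃; _×_; _,_)
open import Data.Sum using (_⊎_)
open import Relation.Nullary using (¬_; does)
open import Relation.Binary.PropositionalEquality using (_≡_; _≢_)

-- Looped simple graphs on vertex set Fin n, given by their GF(2)
-- adjacency matrix A(G): A v w = true iff v,w adjacent (v ≠ w), and
-- A v v = true iff v is looped.  GF(2) = Bool with _xor_ as +, _∧_ as ·.

Graph : ℕ → Set
Graph n = Fin n → Fin n → Bool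

Symmetric : ∀ {n} → Graph n → Set
Symmetric {n} A = (v w : Fin n) → A v w ≡ A w v

_==_ : ∀ {n} → Fin n → Fin n → Bool
v == w = does (v ≟ w)

nbr : ∀ {n} → Graph n → Fin n → Fin n → Bool
nbr A v w = not (v == w) ∧ A v w

IsNbr : ∀ {n} → Graph n → Fin n → Fin n → Set
IsNbr A v w = nbr A v w ≡ true

deg : ∀ {n} → Graph n → Fin n → ℕ
deg A v = ∣ tabulate (nbr A v) ∣

opℓ : ∀ {n} → Fin n → Graph n → Graph n
opℓ v A x y = A x y xor ((x == v) ∧ (y == v))

ops : ∀ {n} → Fin n → Graph n → Graph n
ops v A x y = A x y xor (not (x == y) ∧ nbr A v x ∧ nbr A v y)

opns : ∀ {n} → Fin n → Graph n → Graph n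
opns v A x y = A x y xor (nbr A v x ∧ nbr A v y)

data LocEq {n : ℕ} : Graph n → Graph n → Set where
  done : ∀ {G} → LocEq G G
  stepℓ  : ∀ {G H} (v : Fin n) → LocEq (opℓ v G) H → LocEq G H
  steps  : ∀ {G H} (v : Fin n) → LocEq (ops v G) H → LocEq G H
  stepns : ∀ {G H} (v : Fin n) → LocEq (opns v G) H → LocEq G H

-- The isotropic matrix IAS(G) = (I  A  A+I) and its matroid

data Label : Set where
  φ χ ψ : Label

col : ∀ {n} → Graph n → Fin n → Label → (Fin n → Bool)
col A v φ w = w == v
col A v χ w = A w v
col A v ψ w = A w v xor (w == v)

⨁ : ∀ {n} → (Fin n → Bool) → Bool
⨁ {zero}  f = false
⨁ {suc n} f = f zero xor ⨁ (λ i → f (suc i))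

-- A transversal: one label per vertex, i.e. the set {(v, τ v) | v}.
Transversal : ℕ → Set
Transversal n = Fin n → Label

-- Subsets of the transversal τ are identified with vertex subsets
-- S : Subset n, via S ↦ {(v, τ v) | v ∈ S}.
-- Sum of the columns of the elements of S:
colSum : ∀ {n} → Graph n → Transversal n → Subset n → (Fin n → Bool)
colSum A τ S w = ⨁ (λ v → lookup S v ∧ col A v (τ v) w)

-- Dependence in the binary matroid M[IAS(G)] restricted to τ:
-- the family of columns indexed by S is linearly dependent over GF(2),
-- i.e. some nonempty subfamily sums to zero.
Dependent : ∀ {n} → Graph n → Transversal n → Subset n → Set
Dependent {n} A τ S =
  Σ (Subset n) λ T → T ⊆ S × Nonempty T × ((w : Fin n) → colSum A τ T w ≡ false)

Circuit : ∀ {n} → Graph n → Transversal n → Subset n → Set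
Circuit {n} A τ C = Dependent A τ C × ((D : Subset n) → D ⊂ C → ¬ Dependent A τ D)

-- After relabelling transversals suitably, each local operation acts on the
-- columns of IAS(G) as an invertible row operation (RowOp), so locally
-- equivalent graphs have the same transverse matroids, cycle for cycle
-- (locEq-simulates).  Columns labelled φ are unit vectors, which reduces a
-- column sum to its few non-φ columns (colSum-pivots).
-- (1) ⇒ (2): in H, label u and w by the label whose column is their
-- neighbourhood vector and everything else by φ; the circuits are then exactly
-- N[u] and N[w] (NeighbourhoodCircuit), and they transfer to G.
-- (2) ⇒ (1): removing one vertex cᵢ from each circuit Cᵢ leaves an independent
-- set S; local complementations make S φ-labelled without changing the cycles
-- (normalise), and then each Cᵢ is a cycle whose only non-φ vertex is cᵢ,
-- hence Cᵢ = N[cᵢ] (cycle-closedNbhd), which gives H.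
module Submission where

open import Defs
open import Data.Nat using (ℕ; _+_)
open import Data.Fin using (Fin)
open import Data.Fin.Subset using (Subset; _∈_; _⊆_; _∪_; ∣_∣)
open import Data.Bool using (false)
open import Data.Product using (Σ; _×_)
open import Data.Sum using (_⊎_)
open import Relation.Nullary using (¬_)
open import Relation.Binary.PropositionalEquality using (_≡_; _≢_)
open import Function.Bundles using (_⇔_)

open import Algebra.Bundles using (CommutativeRing)
open import Data.Bool using (Bool; true; not; _∧_; _∨_; _xor_; if_then_else_)
open import Data.Bool.Properties
  using (∧-comm; ∧-idem; ∧-zeroʳ; ∧-identityʳ; ∨-zeroʳ; xor-same; xor-assoc; xor-identityʳ;
         xor-∧-commutativeRing)
import Data.Bool.Properties as Bool
open import Algebra.Properties.CommutativeSemigroup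
  (CommutativeRing.+-commutativeSemigroup xor-∧-commutativeRing) using (interchange; xy∙z≈xz∙y)
open import Data.Empty using (⊥-elim)
open import Data.Fin using (zero; suc; _≟_)
open import Data.Fin.Properties using (suc-injective; any?; all?)
open import Data.Fin.Subset using (_⊂_; Nonempty; _─_; _-_; ⁅_⁆; inside)
open import Data.Fin.Subset.Properties
  using (⊆-refl; ⊆-antisym; _∈?_; _⊆?_; _⊂?_; nonempty?; anySubset?; p⊂q⇒∣p∣<∣q∣; p⊆q⇒∣p∣≤∣q∣;
         x∈p∧x≢y⇒x∈p-y; p─q⊆p; x∈⁅x⁆; x∈p∪q⁺)
open import Data.Nat using (zero; suc; _<_; _≤_)
open import Data.Nat.Base using (s≤s⁻¹)
open import Data.Nat.Properties using (+-comm; <-≤-trans; ≤-trans; n<1+n)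
open import Data.Product using (_,_; proj₁; proj₂)
import Data.Product as Prod
open import Data.Sum using (inj₁; inj₂)
open import Data.Vec using (lookup; tabulate; _∷_; here; there)
open import Data.Vec.Properties using (lookup∘tabulate; tabulate∘lookup; tabulate-cong; []=⇒lookup; lookup⇒[]=)
open import Function using (_∘_)
open import Function.Bundles using (mk⇔; Equivalence)
import Function.Properties.Equivalence as ⇔
open import Relation.Nullary using (Dec; yes; no)
open import Relation.Nullary.Decidable using (_×-dec_; ¬?)
open import Relation.Binary.PropositionalEquality
  using (refl; sym; trans; cong; cong₂; subst; module ≡-Reasoning)
open ≡-Reasoning

true≢false : true ≢ false
true≢false ()

xor-cancel : ∀ {a b} → a xor b ≡ false → a ≡ b
xor-cancel {true}  {true}  _ = refl
xor-cancel {false} {false} _ = refl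

∧-true⁻ : ∀ {a b} → a ∧ b ≡ true → a ≡ true × b ≡ true
∧-true⁻ {true} {true} _ = refl , refl

==-refl : ∀ {n} (x : Fin n) → (x == x) ≡ true
==-refl x with x ≟ x
... | yes _  = refl
... | no x≢x = ⊥-elim (x≢x refl)

==-false : ∀ {n} {x y : Fin n} → x ≢ y → (x == y) ≡ false
==-false {x = x} {y} x≢y with x ≟ y
... | yes x≡y = ⊥-elim (x≢y x≡y)
... | no _    = refl

==-false⁻ : ∀ {n} {x y : Fin n} → (x == y) ≡ false → x ≢ y
==-false⁻ {x = x} x==y refl = true≢false (trans (sym (==-refl x)) x==y)

==-sym : ∀ {n} (x y : Fin n) → (x == y) ≡ (y == x)
==-sym x y with x ≟ y | y ≟ x
... | yes _   | yes _   = refl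
... | no _    | no _    = refl
... | yes x≡y | no y≢x  = ⊥-elim (y≢x (sym x≡y))
... | no x≢y  | yes y≡x = ⊥-elim (x≢y (sym y≡x))

⨁-cong : ∀ {n} {f g : Fin n → Bool} → (∀ i → f i ≡ g i) → ⨁ f ≡ ⨁ g
⨁-cong {zero}  e = refl
⨁-cong {suc n} e = cong₂ _xor_ (e zero) (⨁-cong (e ∘ suc))

⨁-zero : ∀ {n} → ⨁ {n} (λ _ → false) ≡ false
⨁-zero {zero}  = refl
⨁-zero {suc n} = ⨁-zero {n}

⨁-xor : ∀ {n} (f g : Fin n → Bool) → ⨁ (λ i → f i xor g i) ≡ ⨁ f xor ⨁ g
⨁-xor {zero}  f g = refl
⨁-xor {suc n} f g = trans (cong ((f zero xor g zero) xor_) (⨁-xor (f ∘ suc) (g ∘ suc)))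
                          (interchange (f zero) (g zero) (⨁ (f ∘ suc)) (⨁ (g ∘ suc)))

⨁-scale : ∀ {n} (b : Bool) (f : Fin n → Bool) → ⨁ (λ i → b ∧ f i) ≡ b ∧ ⨁ f
⨁-scale true  f = refl
⨁-scale {n} false f = ⨁-zero {n}

⨁-point : ∀ {n} (f : Fin n → Bool) (c : Fin n) → (∀ v → v ≢ c → f v ≡ false) → ⨁ f ≡ f c
⨁-point {suc n} f zero off =
  trans (cong (f zero xor_) (trans (⨁-cong (λ i → off (suc i) λ ())) (⨁-zero {n}))) (xor-identityʳ (f zero))
⨁-point {suc n} f (suc c) off =
  trans (cong (_xor ⨁ (f ∘ suc)) (off zero λ ()))
        (⨁-point (f ∘ suc) c (λ v v≢c → off (suc v) (v≢c ∘ suc-injective)))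

⨁-delta : ∀ {n} (f : Fin n → Bool) (w : Fin n) → ⨁ (λ v → f v ∧ (w == v)) ≡ f w
⨁-delta f w = begin
  ⨁ (λ v → f v ∧ (w == v)) ≡⟨ ⨁-point _ w off ⟩
  f w ∧ (w == w)           ≡⟨ cong (f w ∧_) (==-refl w) ⟩
  f w ∧ true               ≡⟨ ∧-identityʳ (f w) ⟩
  f w                      ∎
  where
  off : ∀ v → v ≢ w → f v ∧ (w == v) ≡ false
  off v v≢w = trans (cong (f v ∧_) (==-false (v≢w ∘ sym))) (∧-zeroʳ (f v))

⨁-pair : ∀ {n} (f : Fin n → Bool) {u w : Fin n} → u ≢ w →
  (∀ v → v ≢ u → v ≢ w → f v ≡ false) → ⨁ f ≡ f u xor f w
⨁-pair f {u} {w} u≢w off = begin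
  ⨁ f
    ≡⟨ ⨁-cong split ⟩
  ⨁ (λ v → ((v == u) ∧ f v) xor (not (v == u) ∧ f v))
    ≡⟨ ⨁-xor (λ v → (v == u) ∧ f v) (λ v → not (v == u) ∧ f v) ⟩
  ⨁ (λ v → (v == u) ∧ f v) xor ⨁ (λ v → not (v == u) ∧ f v)
    ≡⟨ cong₂ _xor_ (⨁-point _ u atU) (⨁-point _ w atW) ⟩
  ((u == u) ∧ f u) xor (not (w == u) ∧ f w)
    ≡⟨ cong₂ (λ a b → (a ∧ f u) xor (not b ∧ f w)) (==-refl u) (==-false (u≢w ∘ sym)) ⟩
  f u xor f w
    ∎
  where
  split : ∀ v → f v ≡ ((v == u) ∧ f v) xor (not (v == u) ∧ f v)
  split v with v == u
  ... | true  = sym (xor-identityʳ (f v))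
  ... | false = refl
  atU : ∀ v → v ≢ u → (v == u) ∧ f v ≡ false
  atU v v≢u = cong (_∧ f v) (==-false v≢u)
  atW : ∀ v → v ≢ w → not (v == u) ∧ f v ≡ false
  atW v v≢w with v ≟ u
  ... | yes refl = refl
  ... | no v≢u   = off v v≢u v≢w

∈⇒lookup : ∀ {n} {S : Subset n} {x : Fin n} → x ∈ S → lookup S x ≡ true
∈⇒lookup = []=⇒lookup

lookup⇒∈ : ∀ {n} {S : Subset n} {x : Fin n} → lookup S x ≡ true → x ∈ S
lookup⇒∈ {S = S} {x} = lookup⇒[]= x S

∈-tabulate⁻ : ∀ {n} (f : Fin n → Bool) {x : Fin n} → x ∈ tabulate f → f x ≡ true
∈-tabulate⁻ f {x} x∈ = trans (sym (lookup∘tabulate f x)) (∈⇒lookup x∈)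

∈-tabulate⁺ : ∀ {n} (f : Fin n → Bool) {x : Fin n} → f x ≡ true → x ∈ tabulate f
∈-tabulate⁺ f {x} fx = lookup⇒∈ (trans (lookup∘tabulate f x) fx)

∉⇒lookup : ∀ {n} {S : Subset n} {x : Fin n} → ¬ x ∈ S → lookup S x ≡ false
∉⇒lookup {S = S} {x} x∉S with lookup S x in Sx
... | true  = ⊥-elim (x∉S (lookup⇒∈ Sx))
... | false = refl

subset-ext : ∀ {n} {p q : Subset n} → (∀ z → lookup p z ≡ lookup q z) → p ≡ q
subset-ext {p = p} {q} p≗q = trans (sym (tabulate∘lookup p)) (trans (tabulate-cong p≗q) (tabulate∘lookup q))

∣insert∣ : ∀ {n} (f : Fin n → Bool) (u : Fin n) → f u ≡ false →
  ∣ tabulate (λ z → (z == u) ∨ f z) ∣ ≡ suc ∣ tabulate f ∣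
∣insert∣ f zero fu≡false rewrite fu≡false = refl
∣insert∣ f (suc u) fu≡false with f zero
... | true  = cong suc (∣insert∣ (f ∘ suc) u fu≡false)
... | false = ∣insert∣ (f ∘ suc) u fu≡false

∉─ : ∀ {n} (p q : Subset n) {x : Fin n} → x ∈ q → ¬ x ∈ p ─ q
∉─ (_ ∷ p) (inside ∷ q) here        ()
∉─ (_ ∷ p) (_      ∷ q) (there x∈q) (there x∈p─q) = ∉─ p q x∈q x∈p─q

nbr-self : ∀ {n} (G : Graph n) (v : Fin n) → nbr G v v ≡ false
nbr-self G v = cong (λ b → not b ∧ G v v) (==-refl v)

nbr-offDiag : ∀ {n} (G : Graph n) {v x : Fin n} → v ≢ x → nbr G v x ≡ G v x
nbr-offDiag G {v} {x} v≢x = cong (λ b → not b ∧ G v x) (==-false v≢x)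

nbr-sym : ∀ {n} (G : Graph n) → Symmetric G → ∀ v x → nbr G v x ≡ nbr G x v
nbr-sym G symG v x = cong₂ (λ b c → not b ∧ c) (==-sym v x) (symG v x)

adjacency-split : ∀ {n} (G : Graph n) → Symmetric G → ∀ v w →
  G w v ≡ nbr G v w xor ((w == v) ∧ G v v)
adjacency-split G symG v w with w ≟ v
... | yes refl = sym (cong (_xor G w w) (nbr-self G w))
... | no w≢v   = sym (trans (xor-identityʳ (nbr G v w))
                            (trans (nbr-offDiag G (w≢v ∘ sym)) (symG v w)))

closedNbhd : ∀ {n} → Graph n → Fin n → Subset n
closedNbhd G v = tabulate (λ z → (z == v) ∨ nbr G v z)

∣closedNbhd∣ : ∀ {n} (G : Graph n) (v : Fin n) → ∣ closedNbhd G v ∣ ≡ deg G v + 1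
∣closedNbhd∣ G v = trans (∣insert∣ (nbr G v) v (nbr-self G v)) (+-comm 1 (deg G v))

centre∈closedNbhd : ∀ {n} (G : Graph n) (v : Fin n) → v ∈ closedNbhd G v
centre∈closedNbhd G v = ∈-tabulate⁺ (λ z → (z == v) ∨ nbr G v z) (cong (_∨ nbr G v v) (==-refl v))

nbr⇒∈closedNbhd : ∀ {n} (G : Graph n) {v z : Fin n} → nbr G v z ≡ true → z ∈ closedNbhd G v
nbr⇒∈closedNbhd G {v} {z} vz = ∈-tabulate⁺ (λ z → (z == v) ∨ nbr G v z) (trans (cong ((z == v) ∨_) vz) (∨-zeroʳ (z == v)))

lookup-closedNbhd : ∀ {n} (G : Graph n) {v z : Fin n} → z ≢ v → lookup (closedNbhd G v) z ≡ nbr G v z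
lookup-closedNbhd G {v} {z} z≢v =
  trans (lookup∘tabulate (λ z → (z == v) ∨ nbr G v z) z) (cong (_∨ nbr G v z) (==-false z≢v))

isφ : Label → Bool
isφ φ = true
isφ χ = false
isφ ψ = false

φ? : (l : Label) → Dec (l ≡ φ)
φ? φ = yes refl
φ? χ = no λ ()
φ? ψ = no λ ()

-- Toggling the loop of x exchanges the columns χ(x) and ψ(x).
toggle : Bool → Label → Label
toggle false l = l
toggle true  φ = φ
toggle true  χ = ψ
toggle true  ψ = χ

-- The relabelling at the pivot v of a local complementation; b is the loop bit of v.
pivotLabel : Bool → Label → Label
pivotLabel false φ = ψ
pivotLabel false χ = χ
pivotLabel false ψ = φ
pivotLabel true  φ = χ
pivotLabel true  χ = φ
pivotLabel true  ψ = ψ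

pivotLabel-involutive : ∀ b l → pivotLabel b (pivotLabel b l) ≡ l
pivotLabel-involutive false φ = refl
pivotLabel-involutive false χ = refl
pivotLabel-involutive false ψ = refl
pivotLabel-involutive true  φ = refl
pivotLabel-involutive true  χ = refl
pivotLabel-involutive true  ψ = refl

-- The column of label l at a vertex, in terms of the neighbourhood bit a,
-- the diagonal bit d and the loop bit L of that vertex.
colForm : Label → Bool → Bool → Bool → Bool
colForm φ a d L = d
colForm χ a d L = a xor (d ∧ L)
colForm ψ a d L = (a xor (d ∧ L)) xor d

col-normalForm : ∀ {n} (G : Graph n) → Symmetric G → ∀ v l w →
  col G v l w ≡ colForm l (nbr G v w) (w == v) (G v v)
col-normalForm G symG v φ w = refl
col-normalForm G symG v χ w = adjacency-split G symG v w
col-normalForm G symG v ψ w = cong (_xor (w == v)) (adjacency-split G symG v w)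

col-diagonal : ∀ {n} (G : Graph n) x l → col G x l x ≡ colForm l false true (G x x)
col-diagonal G x φ = ==-refl x
col-diagonal G x χ = refl
col-diagonal G x ψ = cong (G x x xor_) (==-refl x)

col-offDiagonal : ∀ {n} (G : Graph n) → Symmetric G → ∀ {x} l {z} → l ≢ φ → z ≢ x →
  col G x l z ≡ nbr G x z
col-offDiagonal G symG {x} l {z} l≢φ z≢x =
  trans (col-normalForm G symG x l z)
        (trans (cong (λ d → colForm l (nbr G x z) d (G x x)) (==-false z≢x)) (offDiag l l≢φ))
  where
  offDiag : ∀ l → l ≢ φ → colForm l (nbr G x z) false (G x x) ≡ nbr G x z
  offDiag φ φ≢φ = ⊥-elim (φ≢φ refl)
  offDiag χ _   = xor-identityʳ (nbr G x z)
  offDiag ψ _   = trans (xor-identityʳ _) (xor-identityʳ (nbr G x z))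

nbrLabel : ∀ {n} → Graph n → Fin n → Label
nbrLabel G v = if G v v then ψ else χ

col-nbrLabel : ∀ {n} (G : Graph n) → Symmetric G → ∀ v z → col G v (nbrLabel G v) z ≡ nbr G v z
col-nbrLabel G symG v z =
  trans (col-normalForm G symG v (nbrLabel G v) z) (nbrForm (nbr G v z) (z == v) (G v v))
  where
  nbrForm : ∀ a d L → colForm (if L then ψ else χ) a d L ≡ a
  nbrForm a     d     false = trans (cong (a xor_) (∧-zeroʳ d)) (xor-identityʳ a)
  nbrForm false false true  = refl
  nbrForm false true  true  = refl
  nbrForm true  false true  = refl
  nbrForm true  true  true  = refl

pivot-identity : ∀ L l a d →
  colForm l a d L ≡ colForm (pivotLabel L l) a d L xor (a ∧ colForm (pivotLabel L l) false true L)
pivot-identity false φ false false = refl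
pivot-identity false φ false true  = refl
pivot-identity false φ true  false = refl
pivot-identity false φ true  true  = refl
pivot-identity false χ false false = refl
pivot-identity false χ false true  = refl
pivot-identity false χ true  false = refl
pivot-identity false χ true  true  = refl
pivot-identity false ψ false false = refl
pivot-identity false ψ false true  = refl
pivot-identity false ψ true  false = refl
pivot-identity false ψ true  true  = refl
pivot-identity true  φ false false = refl
pivot-identity true  φ false true  = refl
pivot-identity true  φ true  false = refl
pivot-identity true  φ true  true  = refl
pivot-identity true  χ false false = refl
pivot-identity true  χ false true  = refl
pivot-identity true  χ true  false = refl
pivot-identity true  χ true  true  = refl
pivot-identity true  ψ false false = refl
pivot-identity true  ψ false true  = refl
pivot-identity true  ψ true  false = refl
pivot-identity true  ψ true  true  = refl

col-toggle : ∀ {n} (A A' : Graph n) (x : Fin n) (t : Bool) →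
  (∀ a → A' a x ≡ A a x xor ((a == x) ∧ t)) → ∀ l w → col A' x l w ≡ col A x (toggle t l) w
col-toggle A A' x false entry φ w = refl
col-toggle A A' x false entry χ w = unchanged w
  where
  unchanged : ∀ a → A' a x ≡ A a x
  unchanged a = trans (entry a) (trans (cong (A a x xor_) (∧-zeroʳ (a == x))) (xor-identityʳ (A a x)))
col-toggle A A' x false entry ψ w = cong (_xor (w == x)) (col-toggle A A' x false entry χ w)
col-toggle A A' x true entry φ w = refl
col-toggle A A' x true entry χ w = trans (entry w) (cong (A w x xor_) (∧-identityʳ (w == x)))
col-toggle A A' x true entry ψ w = begin
  A' w x xor (w == x)                        ≡⟨ cong (_xor (w == x)) (col-toggle A A' x true entry χ w) ⟩
  (A w x xor (w == x)) xor (w == x)          ≡⟨ xor-assoc (A w x) (w == x) (w == x) ⟩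
  A w x xor ((w == x) xor (w == x))          ≡⟨ cong (A w x xor_) (xor-same (w == x)) ⟩
  A w x xor false                            ≡⟨ xor-identityʳ (A w x) ⟩
  A w x                                      ∎

Cycle : ∀ {n} → Graph n → Transversal n → Subset n → Set
Cycle {n} G τ T = (w : Fin n) → colSum G τ T w ≡ false

record SameCycles {n} (G : Graph n) (τ : Transversal n) (G' : Graph n) (τ' : Transversal n) : Set where
  constructor sameCycles
  field cycles : (T : Subset n) → Cycle G τ T ⇔ Cycle G' τ' T
open SameCycles

sameCycles-sym : ∀ {n} {G G' : Graph n} {τ τ'} → SameCycles G τ G' τ' → SameCycles G' τ' G τ
sameCycles-sym same = sameCycles λ T → ⇔.sym (cycles same T)

sameCycles-trans : ∀ {n} {G G' G'' : Graph n} {τ τ' τ''} →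
  SameCycles G τ G' τ' → SameCycles G' τ' G'' τ'' → SameCycles G τ G'' τ''
sameCycles-trans same same' = sameCycles λ T → ⇔.trans (cycles same T) (cycles same' T)

sameCycles-cong : ∀ {n} (G : Graph n) {τ τ' : Transversal n} → (∀ x → τ x ≡ τ' x) → SameCycles G τ G τ'
sameCycles-cong G {τ} {τ'} τ≗τ' =
  sameCycles λ T → mk⇔ (λ z w → trans (sym (sums {T} w)) (z w)) (λ z w → trans (sums {T} w) (z w))
  where
  sums : ∀ {T} w → colSum G τ T w ≡ colSum G τ' T w
  sums {T} w = ⨁-cong (λ v → cong (λ l → lookup T v ∧ col G v l w) (τ≗τ' v))

dependent-transport : ∀ {n} {G G' : Graph n} {τ τ'} → SameCycles G τ G' τ' →
  ∀ {S} → Dependent G τ S → Dependent G' τ' S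
dependent-transport same (T , T⊆S , nonempty , cycle) = T , T⊆S , nonempty , Equivalence.to (cycles same T) cycle

circuit-transport : ∀ {n} {G G' : Graph n} {τ τ'} → SameCycles G τ G' τ' →
  ∀ {C} → Circuit G τ C → Circuit G' τ' C
circuit-transport same (dependent , minimal) =
  dependent-transport same dependent ,
  λ D D⊂C dependentD → minimal D D⊂C (dependent-transport (sameCycles-sym same) dependentD)

-- Row operations: how local operations act on the columns of IAS(G)

relabel : ∀ {n} → (Fin n → Label → Label) → Transversal n → Transversal n
relabel σ τ x = σ x (τ x)

record RowOp {n} (G G' : Graph n) (σ : Fin n → Label → Label) (N : Fin n → Bool) (v : Fin n) : Set where
  field
    pivot-row-fixed : N v ≡ false
    column : ∀ x l w → col G' x l w ≡ col G x (σ x l) w xor (N w ∧ col G x (σ x l) v)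

colSum-rowOp : ∀ {n} {G G' : Graph n} {σ N v} → RowOp G G' σ N v → ∀ τ' T w →
  colSum G' τ' T w ≡ colSum G (relabel σ τ') T w xor (N w ∧ colSum G (relabel σ τ') T v)
colSum-rowOp {G = G} {G'} {σ} {N} {v} op τ' T w = begin
  colSum G' τ' T w
    ≡⟨ ⨁-cong (λ y → trans (cong (lookup T y ∧_) (RowOp.column op y (τ' y) w))
                           (distrib (lookup T y) (col G y (τ y) w) (N w) (col G y (τ y) v))) ⟩
  ⨁ (λ y → (lookup T y ∧ col G y (τ y) w) xor (N w ∧ (lookup T y ∧ col G y (τ y) v)))
    ≡⟨ ⨁-xor (λ y → lookup T y ∧ col G y (τ y) w) (λ y → N w ∧ (lookup T y ∧ col G y (τ y) v)) ⟩
  colSum G τ T w xor ⨁ (λ y → N w ∧ (lookup T y ∧ col G y (τ y) v))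
    ≡⟨ cong (colSum G τ T w xor_) (⨁-scale (N w) (λ y → lookup T y ∧ col G y (τ y) v)) ⟩
  colSum G τ T w xor (N w ∧ colSum G τ T v)
    ∎
  where
  τ : Transversal _
  τ = relabel σ τ'
  distrib : ∀ t a m b → t ∧ (a xor (m ∧ b)) ≡ (t ∧ a) xor (m ∧ (t ∧ b))
  distrib true  a m b = refl
  distrib false a m b = sym (∧-zeroʳ m)

-- An invertible row operation does not change which column sets sum to zero.
rowOp-sameCycles : ∀ {n} {G G' : Graph n} {σ N v} → RowOp G G' σ N v →
  ∀ τ' → SameCycles G (relabel σ τ') G' τ'
rowOp-sameCycles {G = G} {G'} {σ} {N} {v} op τ' = sameCycles λ T → mk⇔ (forward T) (backward T)
  where
  τ : Transversal _
  τ = relabel σ τ'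
  forward : ∀ T → Cycle G τ T → Cycle G' τ' T
  forward T cycle w = trans (colSum-rowOp op τ' T w)
    (trans (cong₂ (λ a b → a xor (N w ∧ b)) (cycle w) (cycle v)) (∧-zeroʳ (N w)))
  atPivot : ∀ T → colSum G' τ' T v ≡ colSum G τ T v
  atPivot T = trans (colSum-rowOp op τ' T v)
    (trans (cong (λ b → colSum G τ T v xor (b ∧ colSum G τ T v)) (RowOp.pivot-row-fixed op))
           (xor-identityʳ (colSum G τ T v)))
  backward : ∀ T → Cycle G' τ' T → Cycle G τ T
  backward T cycle w = begin
    colSum G τ T w
      ≡⟨ xor-identityʳ _ ⟨
    colSum G τ T w xor false
      ≡⟨ cong (colSum G τ T w xor_) (∧-zeroʳ (N w)) ⟨
    colSum G τ T w xor (N w ∧ false)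
      ≡⟨ cong (λ b → colSum G τ T w xor (N w ∧ b)) (trans (sym (atPivot T)) (cycle v)) ⟨
    colSum G τ T w xor (N w ∧ colSum G τ T v)
      ≡⟨ colSum-rowOp op τ' T w ⟨
    colSum G' τ' T w
      ≡⟨ cycle w ⟩
    false
      ∎

rowOp-precompose : ∀ {n} {G G' G'' : Graph n} {σ N v} (ρ : Fin n → Label → Label) →
  RowOp G G' σ N v → (∀ x l w → col G'' x l w ≡ col G' x (ρ x l) w) →
  RowOp G G'' (λ x l → σ x (ρ x l)) N v
rowOp-precompose ρ op cols = record
  { pivot-row-fixed = RowOp.pivot-row-fixed op
  ; column = λ x l w → trans (cols x l w) (RowOp.column op x (ρ x l) w)
  }

rowOp-ℓ : ∀ {n} (G : Graph n) (v : Fin n) → RowOp G (opℓ v G) (λ x → toggle (x == v)) (λ _ → false) v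
rowOp-ℓ G v = record
  { pivot-row-fixed = refl
  ; column = λ x l w → trans (col-toggle G (opℓ v G) x (x == v) (loop x) l w)
                             (sym (xor-identityʳ (col G x (toggle (x == v) l) w)))
  }
  where
  loop : ∀ x a → opℓ v G a x ≡ G a x xor ((a == x) ∧ (x == v))
  loop x a with x ≟ v
  ... | yes refl = refl
  ... | no _     = cong (G a x xor_) (trans (∧-zeroʳ (a == v)) (sym (∧-zeroʳ (a == x))))

relabel-ns : ∀ {n} → Graph n → Fin n → Fin n → Label → Label
relabel-ns G v x l = if x == v then pivotLabel (G v v) l else l

-- The relabelling is an involution, so it also maps transversals of G to those of G^v_ns.
relabel-ns-involutive : ∀ {n} (G : Graph n) (v x : Fin n) l → relabel-ns G v x (relabel-ns G v x l) ≡ l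
relabel-ns-involutive G v x l with x == v
... | true  = pivotLabel-involutive (G v v) l
... | false = refl

rowOp-ns : ∀ {n} (G : Graph n) → Symmetric G → ∀ v → RowOp G (opns v G) (relabel-ns G v) (nbr G v) v
rowOp-ns G symG v = record { pivot-row-fixed = nbr-self G v ; column = column }
  where
  column : ∀ x l w → col (opns v G) x l w ≡
    col G x (relabel-ns G v x l) w xor (nbr G v w ∧ col G x (relabel-ns G v x l) v)
  column x l w with x ≟ v
  ... | yes refl = begin
    col (opns x G) x l w                    ≡⟨ col-toggle G (opns x G) x false pivotColumn l w ⟩
    col G x l w                             ≡⟨ col-normalForm G symG x l w ⟩
    colForm l a d L                         ≡⟨ pivot-identity L l a d ⟩
    colForm m a d L xor (a ∧ colForm m false true L)
      ≡⟨ cong₂ (λ p q → p xor (a ∧ q)) (col-normalForm G symG x m w) (col-diagonal G x m) ⟨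
    col G x m w xor (a ∧ col G x m x)       ∎
    where
    a d L : Bool
    a = nbr G x w
    d = w == x
    L = G x x
    m : Label
    m = pivotLabel L l
    pivotColumn : ∀ y → opns x G y x ≡ G y x xor ((y == x) ∧ false)
    pivotColumn y = cong (G y x xor_)
      (trans (cong (nbr G x y ∧_) (nbr-self G x)) (trans (∧-zeroʳ (nbr G x y)) (sym (∧-zeroʳ (y == x)))))
  ... | no x≢v = offPivot l
    where
    N = nbr G v
    edge : N x ≡ G v x
    edge = nbr-offDiag G (x≢v ∘ sym)
    offPivot : ∀ l → col (opns v G) x l w ≡ col G x l w xor (N w ∧ col G x l v)
    offPivot φ = sym (trans (cong (λ b → (w == x) xor (N w ∧ b)) (==-false (x≢v ∘ sym)))
                            (trans (cong ((w == x) xor_) (∧-zeroʳ (N w))) (xor-identityʳ (w == x))))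
    offPivot χ = cong (λ b → G w x xor (N w ∧ b)) edge
    offPivot ψ = begin
      (G w x xor (N w ∧ N x)) xor (w == x)     ≡⟨ xy∙z≈xz∙y (G w x) (N w ∧ N x) (w == x) ⟩
      (G w x xor (w == x)) xor (N w ∧ N x)     ≡⟨ cong (λ b → (G w x xor (w == x)) xor (N w ∧ b)) edge' ⟩
      (G w x xor (w == x)) xor (N w ∧ (G v x xor (v == x))) ∎
      where
      edge' : N x ≡ G v x xor (v == x)
      edge' = trans edge (sym (trans (cong (G v x xor_) (==-false (x≢v ∘ sym))) (xor-identityʳ (G v x))))

ops-loops : ∀ {n} (G : Graph n) (v x a : Fin n) → ops v G a x ≡ opns v G a x xor ((a == x) ∧ nbr G v x)
ops-loops G v x a with a ≟ x
... | yes refl = sym (begin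
  (G x x xor (N x ∧ N x)) xor N x  ≡⟨ cong (λ p → (G x x xor p) xor N x) (∧-idem (N x)) ⟩
  (G x x xor N x) xor N x          ≡⟨ xor-assoc (G x x) (N x) (N x) ⟩
  G x x xor (N x xor N x)          ≡⟨ cong (G x x xor_) (xor-same (N x)) ⟩
  G x x xor false                  ∎)
  where N = nbr G v
... | no _ = sym (xor-identityʳ _)

rowOp-s : ∀ {n} (G : Graph n) → Symmetric G → ∀ v →
  RowOp G (ops v G) (λ x l → relabel-ns G v x (toggle (nbr G v x) l)) (nbr G v) v
rowOp-s G symG v = rowOp-precompose (λ x → toggle (nbr G v x)) (rowOp-ns G symG v)
  (λ x → col-toggle (opns v G) (ops v G) x (nbr G v x) (ops-loops G v x))

symmetric-ℓ : ∀ {n} (G : Graph n) v → Symmetric G → Symmetric (opℓ v G)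
symmetric-ℓ G v symG x y = cong₂ _xor_ (symG x y) (∧-comm (x == v) (y == v))

symmetric-ns : ∀ {n} (G : Graph n) v → Symmetric G → Symmetric (opns v G)
symmetric-ns G v symG x y = cong₂ _xor_ (symG x y) (∧-comm (nbr G v x) (nbr G v y))

symmetric-s : ∀ {n} (G : Graph n) v → Symmetric G → Symmetric (ops v G)
symmetric-s G v symG x y =
  cong₂ _xor_ (symG x y) (cong₂ (λ b c → not b ∧ c) (==-sym x y) (∧-comm (nbr G v x) (nbr G v y)))

-- Local equivalence preserves transverse matroids

Simulates : ∀ {n} → Graph n → Graph n → Set
Simulates {n} G G' = (τ' : Transversal n) → Σ (Transversal n) λ τ → SameCycles G τ G' τ'

rowOp-simulates : ∀ {n} {G G' : Graph n} {σ N v} → RowOp G G' σ N v → Simulates G G'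
rowOp-simulates {σ = σ} op τ' = relabel σ τ' , rowOp-sameCycles op τ'

simulates-trans : ∀ {n} {G G' G'' : Graph n} → Simulates G G' → Simulates G' G'' → Simulates G G''
simulates-trans sim sim' τ'' =
  let τ' , same' = sim' τ''
      τ  , same  = sim τ'
  in  τ , sameCycles-trans same same'

locEq-simulates : ∀ {n} {G H : Graph n} → Symmetric G → LocEq G H → Symmetric H × Simulates G H
locEq-simulates symG done = symG , λ τ → τ , sameCycles λ T → ⇔.refl
locEq-simulates {G = G} symG (stepℓ v rest) =
  Prod.map₂ (simulates-trans (rowOp-simulates (rowOp-ℓ G v)))
            (locEq-simulates (symmetric-ℓ G v symG) rest)
locEq-simulates {G = G} symG (steps v rest) =
  Prod.map₂ (simulates-trans (rowOp-simulates (rowOp-s G symG v)))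
            (locEq-simulates (symmetric-s G v symG) rest)
locEq-simulates {G = G} symG (stepns v rest) =
  Prod.map₂ (simulates-trans (rowOp-simulates (rowOp-ns G symG v)))
            (locEq-simulates (symmetric-ns G v symG) rest)

⊆⇒≡⊎⊂ : ∀ {n} {C D : Subset n} → C ⊆ D → C ≡ D ⊎ C ⊂ D
⊆⇒≡⊎⊂ {C = C} {D} C⊆D with any? (λ x → x ∈? D ×-dec ¬? (x ∈? C))
... | yes (x , x∈D , x∉C) = inj₂ (C⊆D , x , x∈D , x∉C)
... | no noneMissing = inj₁ (⊆-antisym C⊆D D⊆C)
  where
  D⊆C : D ⊆ C
  D⊆C {x} x∈D with x ∈? C
  ... | yes x∈C = x∈C
  ... | no x∉C  = ⊥-elim (noneMissing (x , x∈D , x∉C))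

circuit-nonempty : ∀ {n} {G : Graph n} {τ C} → Circuit G τ C → Nonempty C
circuit-nonempty ((T , T⊆C , (x , x∈T) , _) , _) = x , T⊆C x∈T

circuit-is-cycle : ∀ {n} {G : Graph n} {τ C} → Circuit G τ C → Cycle G τ C
circuit-is-cycle ((T , T⊆C , nonempty , cycle) , minimal) with ⊆⇒≡⊎⊂ T⊆C
... | inj₁ refl = cycle
... | inj₂ T⊂C  = ⊥-elim (minimal T T⊂C (T , ⊆-refl , nonempty , cycle))

circuit-⊆ : ∀ {n} {G : Graph n} {τ C D} → Circuit G τ C → Circuit G τ D → C ⊆ D → D ≡ C
circuit-⊆ (dependentC , _) (_ , minimalD) C⊆D with ⊆⇒≡⊎⊂ C⊆D
... | inj₁ C≡D = sym C≡D
... | inj₂ C⊂D = ⊥-elim (minimalD _ C⊂D dependentC)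

dependent? : ∀ {n} (G : Graph n) τ (S : Subset n) → Dec (Dependent G τ S)
dependent? G τ S = anySubset? λ T →
  (T ⊆? S) ×-dec (nonempty? T ×-dec all? (λ w → colSum G τ T w Bool.≟ false))

circuit-within : ∀ {n} (G : Graph n) τ {S : Subset n} → Dependent G τ S →
  Σ (Subset n) λ D → Circuit G τ D × D ⊆ S
circuit-within {n} G τ {S} = search (suc ∣ S ∣) S (n<1+n ∣ S ∣)
  where
  search : ∀ k S → ∣ S ∣ < k → Dependent G τ S → Σ (Subset n) λ D → Circuit G τ D × D ⊆ S
  search zero    S ()    _
  search (suc k) S bound dependentS with anySubset? (λ D → D ⊂? S ×-dec dependent? G τ D)
  ... | no noSmaller = S , (dependentS , λ D D⊂S dependentD → noSmaller (D , D⊂S , dependentD)) , ⊆-refl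
  ... | yes (D , D⊂S , dependentD) =
    let E , circuitE , E⊆D = search k D (<-≤-trans (p⊂q⇒∣p∣<∣q∣ D⊂S) (s≤s⁻¹ bound)) dependentD
    in  E , circuitE , λ x∈E → proj₁ D⊂S (E⊆D x∈E)

-- φ-columns are unit vectors: a column sum splits into the columns of the
-- vertices marked by p and the diagonal contribution of the unmarked ones.
colSum-pivots : ∀ {n} (G : Graph n) τ (T : Subset n) (p : Fin n → Bool) →
  (∀ v → v ∈ T → p v ≡ false → τ v ≡ φ) → ∀ w →
  colSum G τ T w ≡ ⨁ (λ v → (lookup T v ∧ p v) ∧ col G v (τ v) w) xor (lookup T w ∧ not (p w))
colSum-pivots G τ T p unitColumn w = begin
  colSum G τ T w
    ≡⟨ ⨁-cong split ⟩
  ⨁ (λ v → marked v xor ((lookup T v ∧ not (p v)) ∧ (w == v)))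
    ≡⟨ ⨁-xor marked (λ v → (lookup T v ∧ not (p v)) ∧ (w == v)) ⟩
  ⨁ marked xor ⨁ (λ v → (lookup T v ∧ not (p v)) ∧ (w == v))
    ≡⟨ cong (⨁ marked xor_) (⨁-delta (λ v → lookup T v ∧ not (p v)) w) ⟩
  ⨁ marked xor (lookup T w ∧ not (p w))
    ∎
  where
  marked : Fin _ → Bool
  marked v = (lookup T v ∧ p v) ∧ col G v (τ v) w
  split : ∀ v → lookup T v ∧ col G v (τ v) w ≡ marked v xor ((lookup T v ∧ not (p v)) ∧ (w == v))
  split v with lookup T v in v∈T | p v in pv
  ... | false | _     = refl
  ... | true  | true  = sym (xor-identityʳ (col G v (τ v) w))
  ... | true  | false = cong (λ l → col G v l w) (unitColumn v (lookup⇒∈ v∈T) pv)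

colSum-pivot : ∀ {n} (G : Graph n) τ (T : Subset n) (c : Fin n) → c ∈ T →
  (∀ v → v ∈ T → v ≢ c → τ v ≡ φ) → ∀ w →
  colSum G τ T w ≡ col G c (τ c) w xor (lookup T w ∧ not (w == c))
colSum-pivot G τ T c c∈T unitColumn w = begin
  colSum G τ T w
    ≡⟨ colSum-pivots G τ T (_== c) (λ v v∈T v≠c → unitColumn v v∈T (==-false⁻ v≠c)) w ⟩
  ⨁ marked xor rest
    ≡⟨ cong (_xor rest) (⨁-point marked c off) ⟩
  ((lookup T c ∧ (c == c)) ∧ col G c (τ c) w) xor rest
    ≡⟨ cong₂ (λ a b → ((a ∧ b) ∧ col G c (τ c) w) xor rest) (∈⇒lookup c∈T) (==-refl c) ⟩
  col G c (τ c) w xor rest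
    ∎
  where
  marked : Fin _ → Bool
  marked v = (lookup T v ∧ (v == c)) ∧ col G v (τ v) w
  rest : Bool
  rest = lookup T w ∧ not (w == c)
  off : ∀ v → v ≢ c → marked v ≡ false
  off v v≢c = cong (_∧ col G v (τ v) w) (trans (cong (lookup T v ∧_) (==-false v≢c)) (∧-zeroʳ (lookup T v)))

colSum-twoPivots : ∀ {n} (G : Graph n) τ (T : Subset n) {u w : Fin n} → u ≢ w →
  (∀ v → v ∈ T → v ≢ u → v ≢ w → τ v ≡ φ) → ∀ z →
  colSum G τ T z ≡ ((lookup T u ∧ col G u (τ u) z) xor (lookup T w ∧ col G w (τ w) z))
                   xor (lookup T z ∧ not ((z == u) ∨ (z == w)))
colSum-twoPivots G τ T {u} {w} u≢w unitColumn z = begin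
  colSum G τ T z
    ≡⟨ colSum-pivots G τ T isPivot unitColumn' z ⟩
  ⨁ marked xor rest
    ≡⟨ cong (_xor rest) (⨁-pair marked u≢w off) ⟩
  (marked u xor marked w) xor rest
    ≡⟨ cong₂ (λ a b → (((lookup T u ∧ a) ∧ col G u (τ u) z) xor ((lookup T w ∧ b) ∧ col G w (τ w) z)) xor rest)
             (cong (_∨ (u == w)) (==-refl u)) (trans (cong ((w == u) ∨_) (==-refl w)) (∨-zeroʳ (w == u))) ⟩
  (((lookup T u ∧ true) ∧ col G u (τ u) z) xor ((lookup T w ∧ true) ∧ col G w (τ w) z)) xor rest
    ≡⟨ cong₂ (λ a b → ((a ∧ col G u (τ u) z) xor (b ∧ col G w (τ w) z)) xor rest)
             (∧-identityʳ (lookup T u)) (∧-identityʳ (lookup T w)) ⟩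
  ((lookup T u ∧ col G u (τ u) z) xor (lookup T w ∧ col G w (τ w) z)) xor rest
    ∎
  where
  isPivot : Fin _ → Bool
  isPivot v = (v == u) ∨ (v == w)
  marked : Fin _ → Bool
  marked v = (lookup T v ∧ isPivot v) ∧ col G v (τ v) z
  rest : Bool
  rest = lookup T z ∧ not (isPivot z)
  unitColumn' : ∀ v → v ∈ T → isPivot v ≡ false → τ v ≡ φ
  unitColumn' v v∈T notPivot with v == u in v==u
  ... | false = unitColumn v v∈T (==-false⁻ v==u) (==-false⁻ notPivot)
  off : ∀ v → v ≢ u → v ≢ w → marked v ≡ false
  off v v≢u v≢w = cong (_∧ col G v (τ v) z)
    (trans (cong (lookup T v ∧_) (cong₂ _∨_ (==-false v≢u) (==-false v≢w))) (∧-zeroʳ (lookup T v)))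

-- (1) ⇒ (2): two far-apart vertices give two closed-neighbourhood circuits

neighbourhoodLabels : ∀ {n} → Graph n → Fin n → Fin n → Transversal n
neighbourhoodLabels H u w z = if (z == u) ∨ (z == w) then nbrLabel H z else φ

module NeighbourhoodCircuit {n} (H : Graph n) (symH : Symmetric H) (u w : Fin n) (u≢w : u ≢ w)
  (nonadjacent : nbr H u w ≡ false) (noCommon : (x : Fin n) → ¬ (IsNbr H u x × IsNbr H w x))
  (τ : Transversal n) (τu : τ u ≡ nbrLabel H u) (τw : τ w ≡ nbrLabel H w)
  (τφ : ∀ z → z ≢ u → z ≢ w → τ z ≡ φ) where

  cycle-equation : ∀ {T} → Cycle H τ T → ∀ z →
    lookup T z ∧ not ((z == u) ∨ (z == w)) ≡ (lookup T u ∧ nbr H u z) xor (lookup T w ∧ nbr H w z)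
  cycle-equation {T} cycle z = sym (xor-cancel (begin
    ((lookup T u ∧ nbr H u z) xor (lookup T w ∧ nbr H w z)) xor (lookup T z ∧ not ((z == u) ∨ (z == w)))
      ≡⟨ cong₂ (λ a b → ((lookup T u ∧ a) xor (lookup T w ∧ b)) xor (lookup T z ∧ not ((z == u) ∨ (z == w))))
               (pivotColumn u τu) (pivotColumn w τw) ⟨
    ((lookup T u ∧ col H u (τ u) z) xor (lookup T w ∧ col H w (τ w) z)) xor (lookup T z ∧ not ((z == u) ∨ (z == w)))
      ≡⟨ colSum-twoPivots H τ T u≢w (λ v _ → τφ v) z ⟨
    colSum H τ T z
      ≡⟨ cycle z ⟩
    false ∎))
    where
    pivotColumn : ∀ v → τ v ≡ nbrLabel H v → col H v (τ v) z ≡ nbr H v z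
    pivotColumn v τv = trans (cong (λ l → col H v l z) τv) (col-nbrLabel H symH v z)

  w∉closedNbhd : ¬ w ∈ closedNbhd H u
  w∉closedNbhd w∈ = true≢false (trans (sym (∈⇒lookup w∈)) (trans (lookup-closedNbhd H (u≢w ∘ sym)) nonadjacent))

  closedNbhd-cycle : Cycle H τ (closedNbhd H u)
  closedNbhd-cycle z = begin
    colSum H τ (closedNbhd H u) z
      ≡⟨ colSum-pivot H τ (closedNbhd H u) u (centre∈closedNbhd H u) unitColumn z ⟩
    col H u (τ u) z xor (lookup (closedNbhd H u) z ∧ not (z == u))
      ≡⟨ cong₂ _xor_ (trans (cong (λ l → col H u l z) τu) (col-nbrLabel H symH u z)) (neighbours z) ⟩
    nbr H u z xor nbr H u z
      ≡⟨ xor-same (nbr H u z) ⟩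
    false ∎
    where
    unitColumn : ∀ v → v ∈ closedNbhd H u → v ≢ u → τ v ≡ φ
    unitColumn v v∈ v≢u = τφ v v≢u λ { refl → w∉closedNbhd v∈ }
    neighbours : ∀ z → lookup (closedNbhd H u) z ∧ not (z == u) ≡ nbr H u z
    neighbours z with z ≟ u
    ... | yes refl = trans (∧-zeroʳ _) (sym (nbr-self H u))
    ... | no z≢u   = trans (∧-identityʳ _) (lookup-closedNbhd H z≢u)

  cycle-through : ∀ {T} → Cycle H τ T → u ∈ T → closedNbhd H u ⊆ T
  cycle-through {T} cycle u∈T {x} x∈ with x ≟ u
  ... | yes refl = u∈T
  ... | no x≢u = lookup⇒∈ (begin
    lookup T x
      ≡⟨ ∧-identityʳ (lookup T x) ⟨
    lookup T x ∧ true
      ≡⟨ cong (λ b → lookup T x ∧ not b) notPivot ⟨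
    lookup T x ∧ not ((x == u) ∨ (x == w))
      ≡⟨ cycle-equation {T} cycle x ⟩
    (lookup T u ∧ nbr H u x) xor (lookup T w ∧ nbr H w x)
      ≡⟨ cong₂ (λ a b → (lookup T u ∧ a) xor (lookup T w ∧ b)) ux wx ⟩
    (lookup T u ∧ true) xor (lookup T w ∧ false)
      ≡⟨ cong₂ (λ a b → (a ∧ true) xor b) (∈⇒lookup u∈T) (∧-zeroʳ (lookup T w)) ⟩
    true
      ∎)
    where
    ux : nbr H u x ≡ true
    ux = trans (sym (lookup-closedNbhd H x≢u)) (∈⇒lookup x∈)
    x≢w : x ≢ w
    x≢w refl = w∉closedNbhd x∈
    wx : nbr H w x ≡ false
    wx with nbr H w x in wx
    ... | true  = ⊥-elim (noCommon x (ux , wx))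
    ... | false = refl
    notPivot : (x == u) ∨ (x == w) ≡ false
    notPivot = cong₂ _∨_ (==-false x≢u) (==-false x≢w)

  cycle-avoiding : ∀ {T} → Cycle H τ T → ¬ u ∈ T → ¬ w ∈ T → ∀ {z} → ¬ z ∈ T
  cycle-avoiding {T} cycle u∉T w∉T {z} z∈T = true≢false (sym (begin
    false
      ≡⟨ cong₂ (λ a b → (a ∧ nbr H u z) xor (b ∧ nbr H w z)) (∉⇒lookup u∉T) (∉⇒lookup w∉T) ⟨
    (lookup T u ∧ nbr H u z) xor (lookup T w ∧ nbr H w z)
      ≡⟨ cycle-equation {T} cycle z ⟨
    lookup T z ∧ not ((z == u) ∨ (z == w))
      ≡⟨ cong₂ (λ a b → a ∧ not b) (∈⇒lookup z∈T) notPivot ⟩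
    true
      ∎))
    where
    notPivot : (z == u) ∨ (z == w) ≡ false
    notPivot = cong₂ _∨_ (==-false {x = z} {u} λ { refl → u∉T z∈T }) (==-false {x = z} {w} λ { refl → w∉T z∈T })

  closedNbhd-circuit : Circuit H τ (closedNbhd H u)
  closedNbhd-circuit =
    (closedNbhd H u , ⊆-refl , (u , centre∈closedNbhd H u) , closedNbhd-cycle) , minimal
    where
    minimal : (D : Subset n) → D ⊂ closedNbhd H u → ¬ Dependent H τ D
    minimal D (D⊆N , x , x∈N , x∉D) (T , T⊆D , (z , z∈T) , cycle) with u ∈? T
    ... | yes u∈T = x∉D (T⊆D (cycle-through {T} cycle u∈T x∈N))
    ... | no u∉T  = cycle-avoiding {T} cycle u∉T (λ w∈T → w∉closedNbhd (D⊆N (T⊆D w∈T))) z∈T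

FarPair : ∀ {n} → Graph n → ℕ → ℕ → Set
FarPair {n} G k₁ k₂ = Σ (Graph n) λ H → LocEq G H × Σ (Fin n) λ u → Σ (Fin n) λ w →
  u ≢ w × H u w ≡ false × deg H u + 1 ≡ k₁ × deg H w + 1 ≡ k₂
  × ((x : Fin n) → ¬ (IsNbr H u x × IsNbr H w x))

CircuitPair : ∀ {n} → Graph n → ℕ → ℕ → Set
CircuitPair {n} G k₁ k₂ = Σ (Transversal n) λ τ → Σ (Subset n) λ C₁ → Σ (Subset n) λ C₂ →
  Circuit G τ C₁ × Circuit G τ C₂ × ((v : Fin n) → ¬ (v ∈ C₁ × v ∈ C₂))
  × ∣ C₁ ∣ ≡ k₁ × ∣ C₂ ∣ ≡ k₂
  × ((D : Subset n) → Circuit G τ D → D ⊆ (C₁ ∪ C₂) → D ≡ C₁ ⊎ D ≡ C₂)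

-- In H with the neighbourhood labels at u and w, the circuits are exactly N[u] and N[w];
-- local equivalence carries them back to a transverse matroid of G.
farPair⇒circuitPair : ∀ {n} {G : Graph n} {k₁ k₂} → Symmetric G → FarPair G k₁ k₂ → CircuitPair G k₁ k₂
farPair⇒circuitPair {n} {G} symG (H , G~H , u , w , u≢w , Huw , degreeU , degreeW , noCommon) =
  τG , closedNbhd H u , closedNbhd H w ,
  circuit-transport toG U.closedNbhd-circuit , circuit-transport toG W.closedNbhd-circuit ,
  disjoint , trans (∣closedNbhd∣ H u) degreeU , trans (∣closedNbhd∣ H w) degreeW ,
  λ D circuitD _ → circuits-of-H (circuit-transport (sameCycles-sym toG) circuitD)
  where
  symH : Symmetric H
  symH = proj₁ (locEq-simulates symG G~H)
  τ : Transversal n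
  τ = neighbourhoodLabels H u w
  τG : Transversal n
  τG = proj₁ (proj₂ (locEq-simulates symG G~H) τ)
  toG : SameCycles H τ G τG
  toG = sameCycles-sym (proj₂ (proj₂ (locEq-simulates symG G~H) τ))
  nonadjacent : nbr H u w ≡ false
  nonadjacent = trans (nbr-offDiag H u≢w) Huw
  τu : τ u ≡ nbrLabel H u
  τu = cong (λ b → if b ∨ (u == w) then nbrLabel H u else φ) (==-refl u)
  τw : τ w ≡ nbrLabel H w
  τw = cong (λ b → if b then nbrLabel H w else φ) (trans (cong ((w == u) ∨_) (==-refl w)) (∨-zeroʳ (w == u)))
  τφ : ∀ z → z ≢ u → z ≢ w → τ z ≡ φ
  τφ z z≢u z≢w = cong (λ b → if b then nbrLabel H z else φ) (cong₂ _∨_ (==-false z≢u) (==-false z≢w))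
  module U = NeighbourhoodCircuit H symH u w u≢w nonadjacent noCommon τ τu τw τφ
  module W = NeighbourhoodCircuit H symH w u (u≢w ∘ sym) (trans (nbr-sym H symH w u) nonadjacent)
    (λ x (wx , ux) → noCommon x (ux , wx)) τ τw τu (λ z z≢w z≢u → τφ z z≢u z≢w)
  disjoint : (v : Fin n) → ¬ (v ∈ closedNbhd H u × v ∈ closedNbhd H w)
  disjoint v (v∈U , v∈W) with v ≟ u | v ≟ w
  ... | yes refl | _        = W.w∉closedNbhd v∈W
  ... | no _     | yes refl = U.w∉closedNbhd v∈U
  ... | no v≢u   | no v≢w   = noCommon v (trans (sym (lookup-closedNbhd H v≢u)) (∈⇒lookup v∈U) ,
                                          trans (sym (lookup-closedNbhd H v≢w)) (∈⇒lookup v∈W))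
  circuits-of-H : ∀ {D} → Circuit H τ D → D ≡ closedNbhd H u ⊎ D ≡ closedNbhd H w
  circuits-of-H {D} circuitD = classify (circuit-is-cycle {G = H} {τ} circuitD)
    where
    classify : Cycle H τ D → D ≡ closedNbhd H u ⊎ D ≡ closedNbhd H w
    classify cycleD with u ∈? D | w ∈? D
    ... | yes u∈D | _       = inj₁ (circuit-⊆ {G = H} {τ} U.closedNbhd-circuit circuitD (U.cycle-through {D} cycleD u∈D))
    ... | no _    | yes w∈D = inj₂ (circuit-⊆ {G = H} {τ} W.closedNbhd-circuit circuitD (W.cycle-through {D} cycleD w∈D))
    ... | no u∉D  | no w∉D  =
      ⊥-elim (U.cycle-avoiding {D} cycleD u∉D w∉D (proj₂ (circuit-nonempty {G = H} {τ} circuitD)))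

-- Making an independent set φ-labelled by local complementations

Keepsφ : ∀ {n} → Subset n → Transversal n → Transversal n → Set
Keepsφ {n} S τ τ' = ∀ z → z ∈ S → τ z ≡ φ → τ' z ≡ φ

-- The vertices of S not labelled φ; their number decreases along the procedure.
unpivoted : ∀ {n} → Subset n → Transversal n → Subset n
unpivoted S τ = tabulate (λ z → lookup S z ∧ not (isφ (τ z)))

not-isφ : ∀ l → l ≢ φ → not (isφ l) ≡ true
not-isφ φ l≢φ = ⊥-elim (l≢φ refl)
not-isφ χ _   = refl
not-isφ ψ _   = refl

∈unpivoted⁺ : ∀ {n} (S : Subset n) τ {z} → z ∈ S → τ z ≢ φ → z ∈ unpivoted S τ
∈unpivoted⁺ S τ {z} z∈S τz≢φ =
  ∈-tabulate⁺ (λ z → lookup S z ∧ not (isφ (τ z))) (cong₂ _∧_ (∈⇒lookup z∈S) (not-isφ (τ z) τz≢φ))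

∈unpivoted⁻ : ∀ {n} (S : Subset n) τ {z} → z ∈ unpivoted S τ → z ∈ S × τ z ≢ φ
∈unpivoted⁻ S τ {z} z∈U =
  let z∈S , notφ = ∧-true⁻ (∈-tabulate⁻ (λ z → lookup S z ∧ not (isφ (τ z))) z∈U)
  in  lookup⇒∈ z∈S , λ τz≡φ → true≢false (trans (sym notφ) (cong (not ∘ isφ) τz≡φ))

unpivoted-mono : ∀ {n} {S : Subset n} {τ τ'} → Keepsφ S τ τ' → unpivoted S τ' ⊆ unpivoted S τ
unpivoted-mono {S = S} {τ} {τ'} keeps z∈U' =
  let z∈S , τ'z≢φ = ∈unpivoted⁻ S τ' z∈U'
  in  ∈unpivoted⁺ S τ z∈S (λ τz≡φ → τ'z≢φ (keeps _ z∈S τz≡φ))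

unpivoted-shrinks : ∀ {n} {S : Subset n} {τ τ' x} → Keepsφ S τ τ' →
  x ∈ S → τ x ≢ φ → τ' x ≡ φ → unpivoted S τ' ⊂ unpivoted S τ
unpivoted-shrinks {S = S} {τ} {τ'} keeps x∈S τx≢φ τ'x≡φ =
  unpivoted-mono keeps , _ , ∈unpivoted⁺ S τ x∈S τx≢φ , λ x∈U' → proj₂ (∈unpivoted⁻ S τ' x∈U') τ'x≡φ

nsRelabel : ∀ {n} → Graph n → Fin n → Transversal n → Transversal n
nsRelabel G v = relabel (relabel-ns G v)

ns-sameCycles : ∀ {n} {G : Graph n} → Symmetric G → ∀ v τ → SameCycles G τ (opns v G) (nsRelabel G v τ)
ns-sameCycles {G = G} symG v τ = sameCycles-trans
  (sameCycles-cong G (λ x → sym (relabel-ns-involutive G v x (τ x))))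
  (rowOp-sameCycles (rowOp-ns G symG v) (nsRelabel G v τ))

nsRelabel-elsewhere : ∀ {n} (G : Graph n) {v} τ {z} → z ≢ v → nsRelabel G v τ z ≡ τ z
nsRelabel-elsewhere G {v} τ {z} z≢v = cong (λ b → if b then pivotLabel (G v v) (τ z) else τ z) (==-false z≢v)

nsRelabel-keeps : ∀ {n} (G : Graph n) {S : Subset n} {τ v} → ¬ (v ∈ S × τ v ≡ φ) → Keepsφ S τ (nsRelabel G v τ)
nsRelabel-keeps G {v = v} unprotected z z∈S τz≡φ with z ≟ v
... | yes refl = ⊥-elim (unprotected (z∈S , τz≡φ))
... | no _     = τz≡φ

pivotLabel-φ : ∀ L l → l ≢ φ → colForm l false true L ≡ true → pivotLabel L l ≡ φ
pivotLabel-φ L     φ l≢φ _  = ⊥-elim (l≢φ refl)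
pivotLabel-φ false χ _   ()
pivotLabel-φ false ψ _   _  = refl
pivotLabel-φ true  χ _   _  = refl
pivotLabel-φ true  ψ _   ()

nsRelabel-pivot : ∀ {n} (G : Graph n) τ {x} → τ x ≢ φ → col G x (τ x) x ≡ true → nsRelabel G x τ x ≡ φ
nsRelabel-pivot G τ {x} τx≢φ diagonal =
  trans (cong (λ b → if b then pivotLabel (G x x) (τ x) else τ x) (==-refl x))
        (pivotLabel-φ (G x x) (τ x) τx≢φ (trans (sym (col-diagonal G x (τ x))) diagonal))

ns-raises-diagonal : ∀ {n} (G : Graph n) → Symmetric G → ∀ τ {x y} → x ≢ y → τ x ≢ φ →
  col G x (τ x) x ≡ false → col G x (τ x) y ≡ true → col (opns y G) x (nsRelabel G y τ x) x ≡ true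
ns-raises-diagonal G symG τ {x} {y} x≢y τx≢φ diagonal entry = begin
  col (opns y G) x (nsRelabel G y τ x) x
    ≡⟨ RowOp.column (rowOp-ns G symG y) x (nsRelabel G y τ x) x ⟩
  col G x l x xor (nbr G y x ∧ col G x l y)
    ≡⟨ cong (λ l → col G x l x xor (nbr G y x ∧ col G x l y)) relabelled ⟩
  col G x (τ x) x xor (nbr G y x ∧ col G x (τ x) y)
    ≡⟨ cong₂ (λ a b → a xor (b ∧ col G x (τ x) y)) diagonal yx ⟩
  col G x (τ x) y
    ≡⟨ entry ⟩
  true ∎
  where
  l : Label
  l = relabel-ns G y x (nsRelabel G y τ x)
  relabelled : l ≡ τ x
  relabelled = relabel-ns-involutive G y x (τ x)
  yx : nbr G y x ≡ true
  yx = trans (nbr-sym G symG y x) (trans (sym (col-offDiagonal G symG (τ x) τx≢φ (x≢y ∘ sym))) entry)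

column-cycle : ∀ {n} (G : Graph n) τ {S : Subset n} {x} → x ∈ S → col G x (τ x) x ≡ false →
  (∀ y → col G x (τ x) y ≡ true → y ∈ S × τ y ≡ φ) → Dependent G τ S
column-cycle {n} G τ {S} {x} x∈S diagonal support = T , T⊆S , (x , x∈T) , cycle
  where
  c : Fin n → Bool
  c = col G x (τ x)
  T : Subset n
  T = tabulate (λ v → (v == x) ∨ c v)
  x∈T : x ∈ T
  x∈T = ∈-tabulate⁺ (λ v → (v == x) ∨ c v) (cong (_∨ c x) (==-refl x))
  inSupport : ∀ {v} → v ∈ T → v ≢ x → c v ≡ true
  inSupport {v} v∈T v≢x = trans (sym (cong (_∨ c v) (==-false v≢x))) (∈-tabulate⁻ (λ v → (v == x) ∨ c v) v∈T)
  T⊆S : T ⊆ S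
  T⊆S {v} v∈T with v ≟ x
  ... | yes refl = x∈S
  ... | no v≢x   = proj₁ (support v (inSupport v∈T v≢x))
  offPivot : ∀ w → lookup T w ∧ not (w == x) ≡ c w
  offPivot w with w ≟ x
  ... | yes refl = trans (∧-zeroʳ (lookup T w)) (sym diagonal)
  ... | no w≢x   = trans (∧-identityʳ (lookup T w))
                         (trans (lookup∘tabulate (λ v → (v == x) ∨ c v) w) (cong (_∨ c w) (==-false w≢x)))
  cycle : Cycle G τ T
  cycle w = begin
    colSum G τ T w
      ≡⟨ colSum-pivot G τ T x x∈T (λ v v∈T v≢x → proj₂ (support v (inSupport v∈T v≢x))) w ⟩
    c w xor (lookup T w ∧ not (w == x))
      ≡⟨ cong (c w xor_) (offPivot w) ⟩
    c w xor c w
      ≡⟨ xor-same (c w) ⟩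
    false
      ∎

record Normalised {n} (S : Subset n) (G : Graph n) (τ : Transversal n) : Set where
  field
    graph       : Graph n
    transversal : Transversal n
    locEq       : LocEq G graph
    symmetric   : Symmetric graph
    same        : SameCycles G τ graph transversal
    φ-on-S      : ∀ z → z ∈ S → transversal z ≡ φ

normalised-ns : ∀ {n} {S : Subset n} {G : Graph n} {τ} → Symmetric G → ∀ v →
  Normalised S (opns v G) (nsRelabel G v τ) → Normalised S G τ
normalised-ns {τ = τ} symG v normal = record
  { graph = graph ; transversal = transversal ; locEq = stepns v locEq ; symmetric = symmetric
  ; same = sameCycles-trans (ns-sameCycles symG v τ) same ; φ-on-S = φ-on-S }
  where open Normalised normal

independent-ns : ∀ {n} {S : Subset n} {G : Graph n} {τ} → Symmetric G → ∀ v →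
  ¬ Dependent G τ S → ¬ Dependent (opns v G) (nsRelabel G v τ) S
independent-ns {τ = τ} symG v independent dependent =
  independent (dependent-transport (sameCycles-sym (ns-sameCycles symG v τ)) dependent)

module Normalisation {n} (S : Subset n) where

  Normaliser : ℕ → Set
  Normaliser k = ∀ {G τ} → Symmetric G → ¬ Dependent G τ S → ∣ unpivoted S τ ∣ < k → Normalised S G τ

  pivot : ∀ {k} → Normaliser k → ∀ {G τ x} → Symmetric G → ¬ Dependent G τ S →
    x ∈ S → τ x ≢ φ → col G x (τ x) x ≡ true → ∣ unpivoted S τ ∣ ≤ k → Normalised S G τ
  pivot normaliser {G} {τ} {x} symG independent x∈S τx≢φ diagonal bound =
    normalised-ns symG x (normaliser (symmetric-ns G x symG) (independent-ns symG x independent)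
      (<-≤-trans (p⊂q⇒∣p∣<∣q∣ (unpivoted-shrinks keeps x∈S τx≢φ (nsRelabel-pivot G τ τx≢φ diagonal))) bound))
    where
    keeps : Keepsφ S τ (nsRelabel G x τ)
    keeps = nsRelabel-keeps G λ (_ , τx≡φ) → τx≢φ τx≡φ

  -- Whether y is a φ-labelled vertex of S; ns-steps at other vertices keep the φ-labels on S.
  protected? : ∀ (τ : Transversal n) y → Dec (y ∈ S × τ y ≡ φ)
  protected? τ y = (y ∈? S) ×-dec φ? (τ y)

  -- If column x has a 0 on the diagonal, it has a 1 at some unprotected vertex,
  -- for otherwise x together with its column would be a cycle inside S.
  unprotectedEntry : ∀ {G τ x} → ¬ Dependent G τ S → x ∈ S → col G x (τ x) x ≡ false →
    Σ (Fin n) λ y → col G x (τ x) y ≡ true × ¬ (y ∈ S × τ y ≡ φ)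
  unprotectedEntry {G} {τ} {x} independent x∈S diagonal
    with any? (λ y → (col G x (τ x) y Bool.≟ true) ×-dec ¬? (protected? τ y))
  ... | yes found = found
  ... | no none   = ⊥-elim (independent (column-cycle G τ x∈S diagonal support))
    where
    support : ∀ y → col G x (τ x) y ≡ true → y ∈ S × τ y ≡ φ
    support y entry with protected? τ y
    ... | yes protected  = protected
    ... | no unprotected = ⊥-elim (none (y , entry , unprotected))

  -- Pivot on an unpivoted x ∈ S, after first creating a 1 on its diagonal by an
  -- ns-step at an unprotected vertex y where column x has a 1.
  normalise-bounded : ∀ k → Normaliser k
  normalise-bounded zero _ _ ()
  normalise-bounded (suc k) {G} {τ} symG independent bound with any? (_∈? unpivoted S τ)
  ... | no allPivoted = record
    { graph = G ; transversal = τ ; locEq = done ; symmetric = symG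
    ; same = sameCycles λ T → ⇔.refl ; φ-on-S = pivoted }
    where
    pivoted : ∀ z → z ∈ S → τ z ≡ φ
    pivoted z z∈S with φ? (τ z)
    ... | yes τz≡φ = τz≡φ
    ... | no τz≢φ  = ⊥-elim (allPivoted (z , ∈unpivoted⁺ S τ z∈S τz≢φ))
  ... | yes (x , x∈U) with ∈unpivoted⁻ S τ x∈U | col G x (τ x) x in diagonal
  ...   | x∈S , τx≢φ | true  = pivot (normalise-bounded k) symG independent x∈S τx≢φ diagonal (s≤s⁻¹ bound)
  ...   | x∈S , τx≢φ | false with unprotectedEntry independent x∈S diagonal
  ...     | y , entry , unprotected =
    normalised-ns symG y (pivot (normalise-bounded k) (symmetric-ns G y symG) (independent-ns symG y independent)
      x∈S τ₁x≢φ (ns-raises-diagonal G symG τ x≢y τx≢φ diagonal entry) bound₁)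
    where
    x≢y : x ≢ y
    x≢y refl = true≢false (trans (sym entry) diagonal)
    τ₁x≢φ : nsRelabel G y τ x ≢ φ
    τ₁x≢φ τ₁x≡φ = τx≢φ (trans (sym (nsRelabel-elsewhere G τ x≢y)) τ₁x≡φ)
    bound₁ : ∣ unpivoted S (nsRelabel G y τ) ∣ ≤ k
    bound₁ = ≤-trans (p⊆q⇒∣p∣≤∣q∣ (unpivoted-mono (nsRelabel-keeps G unprotected))) (s≤s⁻¹ bound)

normalise : ∀ {n} {S : Subset n} {G : Graph n} {τ} → Symmetric G → ¬ Dependent G τ S → Normalised S G τ
normalise {S = S} {τ = τ} symG independent =
  Normalisation.normalise-bounded S (suc ∣ unpivoted S τ ∣) symG independent (n<1+n _)

-- (2) ⇒ (1): circuits with a single non-φ vertex are closed neighbourhoods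

cycle-closedNbhd : ∀ {n} (H : Graph n) → Symmetric H → ∀ {τ C c} → Cycle H τ C → c ∈ C →
  (∀ v → v ∈ C → v ≢ c → τ v ≡ φ) → C ≡ closedNbhd H c
cycle-closedNbhd H symH {τ} {C} {c} cycle c∈C unitColumn = subset-ext members
  where
  column : ∀ z → col H c (τ c) z ≡ lookup C z ∧ not (z == c)
  column z = xor-cancel (trans (sym (colSum-pivot H τ C c c∈C unitColumn z)) (cycle z))
  τc≢φ : τ c ≢ φ
  τc≢φ τc≡φ = true≢false (begin
    true                         ≡⟨ ==-refl c ⟨
    col H c φ c                  ≡⟨ cong (λ l → col H c l c) τc≡φ ⟨
    col H c (τ c) c              ≡⟨ column c ⟩
    lookup C c ∧ not (c == c)    ≡⟨ cong (λ b → lookup C c ∧ not b) (==-refl c) ⟩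
    lookup C c ∧ false           ≡⟨ ∧-zeroʳ (lookup C c) ⟩
    false                        ∎)
  members : ∀ z → lookup C z ≡ lookup (closedNbhd H c) z
  members z with z ≟ c
  ... | yes refl = trans (∈⇒lookup c∈C) (sym (∈⇒lookup (centre∈closedNbhd H z)))
  ... | no z≢c   = begin
    lookup C z                   ≡⟨ ∧-identityʳ (lookup C z) ⟨
    lookup C z ∧ true            ≡⟨ cong (λ b → lookup C z ∧ not b) (==-false z≢c) ⟨
    lookup C z ∧ not (z == c)    ≡⟨ column z ⟨
    col H c (τ c) z              ≡⟨ col-offDiagonal H symH (τ c) τc≢φ z≢c ⟩
    nbr H c z                    ≡⟨ lookup-closedNbhd H z≢c ⟨
    lookup (closedNbhd H c) z    ∎

-- Make everything but one vertex of each circuit φ-labelled; then each circuit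
-- is the closed neighbourhood of its remaining vertex.
circuitPair⇒farPair : ∀ {n} {G : Graph n} {k₁ k₂} → Symmetric G → CircuitPair G k₁ k₂ → FarPair G k₁ k₂
circuitPair⇒farPair {n} {G} symG (τ , C₁ , C₂ , circuit₁ , circuit₂ , disjoint , size₁ , size₂ , onlyTwo) =
  H , locEq , c₁ , c₂ , c₁≢c₂ , nonadjacent , degree nbhd₁ size₁ , degree nbhd₂ size₂ , noCommon
  where
  c₁ c₂ : Fin n
  c₁ = proj₁ (circuit-nonempty {G = G} {τ} circuit₁)
  c₂ = proj₁ (circuit-nonempty {G = G} {τ} circuit₂)
  c₁∈C₁ : c₁ ∈ C₁
  c₁∈C₁ = proj₂ (circuit-nonempty {G = G} {τ} circuit₁)
  c₂∈C₂ : c₂ ∈ C₂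
  c₂∈C₂ = proj₂ (circuit-nonempty {G = G} {τ} circuit₂)
  c₂∉C₁ : ¬ c₂ ∈ C₁
  c₂∉C₁ c₂∈C₁ = disjoint c₂ (c₂∈C₁ , c₂∈C₂)
  c₁≢c₂ : c₁ ≢ c₂
  c₁≢c₂ c₁≡c₂ = c₂∉C₁ (subst (_∈ C₁) c₁≡c₂ c₁∈C₁)

  -- S = C₁ ∪ C₂ minus c₁ and c₂ is independent: the only circuits in C₁ ∪ C₂ are C₁ and C₂.
  S : Subset n
  S = (C₁ ∪ C₂) - c₁ - c₂
  S⊆C₁∪C₂ : S ⊆ C₁ ∪ C₂
  S⊆C₁∪C₂ x∈S = p─q⊆p (C₁ ∪ C₂) ⁅ c₁ ⁆ (p─q⊆p ((C₁ ∪ C₂) - c₁) ⁅ c₂ ⁆ x∈S)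
  c₁∉S : ¬ c₁ ∈ S
  c₁∉S c₁∈S = ∉─ (C₁ ∪ C₂) ⁅ c₁ ⁆ (x∈⁅x⁆ c₁) (p─q⊆p ((C₁ ∪ C₂) - c₁) ⁅ c₂ ⁆ c₁∈S)
  c₂∉S : ¬ c₂ ∈ S
  c₂∉S = ∉─ ((C₁ ∪ C₂) - c₁) ⁅ c₂ ⁆ (x∈⁅x⁆ c₂)
  inS : ∀ {v} → v ∈ C₁ ∪ C₂ → v ≢ c₁ → v ≢ c₂ → v ∈ S
  inS v∈C v≢c₁ v≢c₂ = x∈p∧x≢y⇒x∈p-y (x∈p∧x≢y⇒x∈p-y v∈C v≢c₁) v≢c₂
  independent : ¬ Dependent G τ S
  independent dependent with circuit-within G τ dependent
  ... | D , circuitD , D⊆S with onlyTwo D circuitD (λ x∈D → S⊆C₁∪C₂ (D⊆S x∈D))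
  ...   | inj₁ refl = c₁∉S (D⊆S c₁∈C₁)
  ...   | inj₂ refl = c₂∉S (D⊆S c₂∈C₂)

  open Normalised (normalise {S = S} {G} {τ} symG independent) renaming (graph to H; transversal to τH)

  nbhd₁ : C₁ ≡ closedNbhd H c₁
  nbhd₁ = cycle-closedNbhd H symmetric (circuit-is-cycle {G = H} {τH} (circuit-transport same circuit₁)) c₁∈C₁
    λ v v∈C₁ v≢c₁ → φ-on-S v (inS (x∈p∪q⁺ (inj₁ v∈C₁)) v≢c₁ λ { refl → c₂∉C₁ v∈C₁ })
  nbhd₂ : C₂ ≡ closedNbhd H c₂
  nbhd₂ = cycle-closedNbhd H symmetric (circuit-is-cycle {G = H} {τH} (circuit-transport same circuit₂)) c₂∈C₂
    λ v v∈C₂ v≢c₂ →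
      φ-on-S v (inS (x∈p∪q⁺ (inj₂ v∈C₂)) (λ { refl → disjoint v (c₁∈C₁ , v∈C₂) }) v≢c₂)

  degree : ∀ {C c k} → C ≡ closedNbhd H c → ∣ C ∣ ≡ k → deg H c + 1 ≡ k
  degree {c = c} refl size = trans (sym (∣closedNbhd∣ H c)) size
  nonadjacent : H c₁ c₂ ≡ false
  nonadjacent = begin
    H c₁ c₂                       ≡⟨ nbr-offDiag H c₁≢c₂ ⟨
    nbr H c₁ c₂                   ≡⟨ lookup-closedNbhd H (c₁≢c₂ ∘ sym) ⟨
    lookup (closedNbhd H c₁) c₂   ≡⟨ cong (λ C → lookup C c₂) nbhd₁ ⟨
    lookup C₁ c₂                  ≡⟨ ∉⇒lookup c₂∉C₁ ⟩
    false                         ∎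
  noCommon : (x : Fin n) → ¬ (IsNbr H c₁ x × IsNbr H c₂ x)
  noCommon x (c₁x , c₂x) = disjoint x (subst (x ∈_) (sym nbhd₁) (nbr⇒∈closedNbhd H c₁x) ,
                                       subst (x ∈_) (sym nbhd₂) (nbr⇒∈closedNbhd H c₂x))

corollary46 : {n : ℕ} (G : Graph n) → Symmetric G → (k₁ k₂ : ℕ) →
    (Σ (Graph n) λ H → LocEq G H × Σ (Fin n) λ u → Σ (Fin n) λ w →
        u ≢ w × H u w ≡ false
        × deg H u + 1 ≡ k₁ × deg H w + 1 ≡ k₂
        × ((x : Fin n) → ¬ (IsNbr H u x × IsNbr H w x)))
    ⇔
    (Σ (Transversal n) λ τ → Σ (Subset n) λ C₁ → Σ (Subset n) λ C₂ →
        Circuit G τ C₁ × Circuit G τ C₂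
        × ((v : Fin n) → ¬ (v ∈ C₁ × v ∈ C₂))
        × ∣ C₁ ∣ ≡ k₁ × ∣ C₂ ∣ ≡ k₂
        × ((D : Subset n) → Circuit G τ D → D ⊆ (C₁ ∪ C₂) → D ≡ C₁ ⊎ D ≡ C₂))
corollary46 G symG k₁ k₂ = mk⇔ (farPair⇒circuitPair symG) (circuitPair⇒farPair symG)
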